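{- Let $\pi\in\mathfrak{B}_n$ be a signed involution, $1\le i\le n+1$ and $p\in\{0,1\}$. If $d^+(i,i)=(p,p)$ then $\operatorname{des}^B(\eta_i(\pi))=\operatorname{des}^B(\pi)+p$ and $\operatorname{des}^B(\eta'_i(\pi))=\operatorname{des}^B(\pi)+p+1$. If $d^-(i,i)=(p,p)$ then $\operatorname{des}^B(\overline{\eta}_i(\pi))=\operatorname{des}^B(\pi)+p+1$ and $\operatorname{des}^B(\overline{\eta'}_i(\pi))=\operatorname{des}^B(\pi)+p$.
   Context: $\mathfrak{B}_n$ is the set of signed permutations $\pi=\pi_1\cdots\pi_n$ ($\pi_i\in\{\pm1,\dots,\pm n\}$, $|\pi_1|,\dots,|\pi_n|$ a permutation of $[n]$), $\pi_0=0$; inverse given by $\pi^{ -1}_{|\pi_i|}=\operatorname{sgn}(\pi_i)\,i$; $\pi$ is a signed involution if $\pi^{ -1}=\pi$. Natural order: $\operatorname{des}^B(\pi)=|\{i\in\{0,\dots,n-1\}:\pi_i>\pi_{i+1}\}|$, $\operatorname{ides}^B(\pi)=\operatorname{des}^B(\pi^{ -1})$. For $\pi\in\mathfrak{B}_m$ and $i,j\in[m+1]$, $\varphi_{(i,j)}(\pi)$ is the $\sigma\in\mathfrak{B}_{m+1}$ with $\sigma_i=j$, $\sigma_k=s(\pi_k)$ for $k<i$, $\sigma_k=s(\pi_{k-1})$ for $k>i$, where $s(x)=x$ if $|x|<j$, $s(x)=x+1$ if $x\ge j$, $s(x)=x-1$ if $x\le-j$; $\overline{\varphi}_{(i,j)}(\pi)$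 is the same with $\sigma_i=-j$. $d^+(i,j)=\big(\operatorname{des}^B(\varphi_{(i,j)}(\pi))-\operatorname{des}^B(\pi),\ \operatorname{ides}^B(\varphi_{(i,j)}(\pi))-\operatorname{ides}^B(\pi)\big)$, $d^-(i,j)$ the same with $\overline{\varphi}_{(i,j)}$. Double insertions: $\eta_i=\varphi_{(i,i)}\circ\varphi_{(i,i)}$, $\overline{\eta}_i=\overline{\varphi}_{(i,i)}\circ\overline{\varphi}_{(i,i)}$, $\eta'_i=\varphi_{(i+1,i)}\circ\varphi_{(i,i)}$, $\overline{\eta'}_i=\overline{\varphi}_{(i+1,i)}\circ\overline{\varphi}_{(i,i)}$. -}

module Defs where

open import Data.Bool using (Bool; true; false; if_then_else_)
open import Data.Nat as ℕ using (ℕ; zero; suc; _∸_)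
open import Data.Integer as ℤ using (ℤ; +_; -_; ∣_∣; _+_; _-_)
import Data.Integer.Properties as ℤP
import Data.Nat.Properties as ℕP
open import Data.List using (List; []; _∷_; _++_; map; take; drop; length; applyUpTo)
open import Data.List.Relation.Binary.Permutation.Propositional using (_↭_)
open import Relation.Nullary using (does)

IsSignedPerm : List ℤ → Set
IsSignedPerm π = map ∣_∣ π ↭ applyUpTo suc (length π)

-- Inverse: π⁻¹_{|πᵢ|} = sgn(πᵢ)·i.
-- invEntry k l o : search l (whose first entry has 1-based index o+1)
-- for the entry x with |x| = k, returning sgn(x)·(its index).
invEntry : ℕ → List ℤ → ℕ → ℤ
invEntry k []      o = + 0
invEntry k (x ∷ l) o =
  if does (∣ x ∣ ℕ.≟ k)
  then (if does (+ 0 ℤ.≤? x) then + suc o else - (+ suc o))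
  else invEntry k l (suc o)

inv : List ℤ → List ℤ
inv π = applyUpTo (λ k → invEntry (suc k) π 0) (length π)

IsSignedInvolution : List ℤ → Set
IsSignedInvolution π = IsSignedPerm π Data.Product.× (inv π ≡ π)
  where open import Data.Product
        open import Relation.Binary.PropositionalEquality

desList : List ℤ → ℕ
desList []          = 0
desList (x ∷ [])    = 0
desList (x ∷ y ∷ l) = (if does (y ℤ.<? x) then 1 else 0) ℕ.+ desList (y ∷ l)

desB : List ℤ → ℕ
desB π = desList (+ 0 ∷ π)

idesB : List ℤ → ℕ
idesB π = desB (inv π)

shift : ℕ → ℤ → ℤ
shift j x =
  if does (∣ x ∣ ℕ.<? j) then x
  else (if does (+ 0 ℤ.≤? x) then x + + 1 else x - + 1)

-- insert v so that it becomes the i-th entry (1-based)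
insertAt : ℕ → ℤ → List ℤ → List ℤ
insertAt i v l = take (i ∸ 1) l ++ (v ∷ drop (i ∸ 1) l)

φ : ℕ → ℕ → List ℤ → List ℤ
φ i j π = insertAt i (+ j) (map (shift j) π)

φ̄ : ℕ → ℕ → List ℤ → List ℤ
φ̄ i j π = insertAt i (- (+ j)) (map (shift j) π)

η η̄ η′ η̄′ : ℕ → List ℤ → List ℤ
η   i π = φ i i (φ i i π)
η̄   i π = φ̄ i i (φ̄ i i π)
η′  i π = φ (suc i) i (φ i i π)
η̄′  i π = φ̄ (suc i) i (φ̄ i i π)

-- Write φ_{(i,i)}(π) = X·v·Y with v = ±i, and let s = shift i. Then η_i(π) = s(X)·v·s(v)·s(Y)
-- and η'_i(π) = s(X)·s(v)·v·s(Y), with s(±i) = ±(i+1). The map s is order-preserving and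
-- moves no entry of X or Y across ±i, so the descents of s(X)·v and s(v)·s(Y) (resp. of
-- s(X)·s(v) and v·s(Y)) are those of X·v and v·Y; the only new adjacent pair is {±i, ±(i+1)},
-- which contributes a descent exactly for (i+1, i) and (−i, −i−1).
module Submission where

open import Defs
open import Data.Bool using (Bool; true; false; if_then_else_)
open import Data.Nat as ℕ using (ℕ; zero; suc; _+_; _≤_; z≤n; s≤s)
import Data.Nat.Properties as ℕP
open import Data.Integer as ℤ using (ℤ; +_; -[1+_])
import Data.Integer.Properties as ℤP
open import Data.List using (List; []; _∷_; _++_; map; take; drop; length)
open import Data.List.Properties using (take-map; drop-map; length-map)
open import Data.List.Relation.Unary.All using (All; []; _∷_; universal)
open import Data.List.Relation.Unary.All.Properties using (map⁺)
open import Data.Product using (_×_; _,_)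
open import Relation.Nullary using (does)
open import Relation.Nullary.Decidable using (dec-true; dec-false)
open import Relation.Binary.PropositionalEquality
open ≡-Reasoning

bump : ℕ → ℕ → ℕ
bump j n = if n ℕ.<ᵇ j then n else suc n

bump-suc : ∀ j n → bump (suc j) (suc n) ≡ suc (bump j n)
bump-suc j n with n ℕ.<ᵇ j
... | true  = refl
... | false = refl

bump-self : ∀ j → bump j j ≡ suc j
bump-self zero    = refl
bump-self (suc j) = trans (bump-suc j j) (cong suc (bump-self j))

bump-monotone : ∀ j m n → (bump j m ℕ.<ᵇ bump j n) ≡ (m ℕ.<ᵇ n)
bump-monotone zero    m       n       = refl
bump-monotone (suc j) zero    zero    = refl
bump-monotone (suc j) zero    (suc n) rewrite bump-suc j n = refl
bump-monotone (suc j) (suc m) zero    = refl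
bump-monotone (suc j) (suc m) (suc n) rewrite bump-suc j m | bump-suc j n = bump-monotone j m n

bump-<ᵇ : ∀ j n → (bump j n ℕ.<ᵇ j) ≡ (n ℕ.<ᵇ j)
bump-<ᵇ zero    n       = refl
bump-<ᵇ (suc j) zero    = refl
bump-<ᵇ (suc j) (suc n) rewrite bump-suc j n = bump-<ᵇ j n

<ᵇ-bump² : ∀ j n → (j ℕ.<ᵇ bump j (bump j n)) ≡ (j ℕ.<ᵇ bump j n)
<ᵇ-bump² zero    n       = refl
<ᵇ-bump² (suc j) zero    = refl
<ᵇ-bump² (suc j) (suc n) rewrite bump-suc j n | bump-suc j (bump j n) = <ᵇ-bump² j n

infix 4 _<ᵇ_
_<ᵇ_ : ℤ → ℤ → Bool
x <ᵇ y = does (x ℤ.<? y)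

descent : ℤ → ℤ → ℕ
descent x y = if y <ᵇ x then 1 else 0

OrderPreserving : (ℤ → ℤ) → Set
OrderPreserving h = ∀ x y → (h x <ᵇ h y) ≡ (x <ᵇ y)

shift-pos : ∀ j n → shift j (+ n) ≡ + bump j n
shift-pos j n with n ℕ.<ᵇ j
... | true  = refl
... | false = cong +_ (ℕP.+-comm n 1)

shift-negsuc : ∀ k n → shift (suc k) -[1+ n ] ≡ -[1+ bump k n ]
shift-negsuc k n with n ℕ.<ᵇ k
... | true  = refl
... | false = cong (λ m → -[1+ suc m ]) (ℕP.+-identityʳ n)

shift-monotone : ∀ k → OrderPreserving (shift (suc k))
shift-monotone k (+ m)    (+ n)    rewrite shift-pos (suc k) m | shift-pos (suc k) n = bump-monotone (suc k) m n
shift-monotone k (+ m)    -[1+ n ] rewrite shift-pos (suc k) m | shift-negsuc k n = refl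
shift-monotone k -[1+ m ] (+ n)    rewrite shift-negsuc k m | shift-pos (suc k) n = refl
shift-monotone k -[1+ m ] -[1+ n ] rewrite shift-negsuc k m | shift-negsuc k n = bump-monotone k n m

module _ (k : ℕ) where

  private
    s : ℤ → ℤ
    s = shift (suc k)

  shift-<-pos : ∀ z → (s z <ᵇ + suc k) ≡ (z <ᵇ + suc k)
  shift-<-pos (+ n)    rewrite shift-pos (suc k) n = bump-<ᵇ (suc k) n
  shift-<-pos -[1+ n ] rewrite shift-negsuc k n = refl

  neg-<-shift : ∀ z → (-[1+ k ] <ᵇ s z) ≡ (-[1+ k ] <ᵇ z)
  neg-<-shift (+ n)    rewrite shift-pos (suc k) n = refl
  neg-<-shift -[1+ n ] rewrite shift-negsuc k n = bump-<ᵇ k n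

  -- Stated for values s z only: s changes how ±(k+1) compares with itself, but ±(k+1) is not a value of s.
  pos-<-shift² : ∀ z → (+ suc k <ᵇ s (s z)) ≡ (+ suc k <ᵇ s z)
  pos-<-shift² (+ n)    rewrite shift-pos (suc k) n | shift-pos (suc k) (bump (suc k) n) = <ᵇ-bump² (suc k) n
  pos-<-shift² -[1+ n ] rewrite shift-negsuc k n | shift-negsuc k (bump k n) = refl

  shift²-<-neg : ∀ z → (s (s z) <ᵇ -[1+ k ]) ≡ (s z <ᵇ -[1+ k ])
  shift²-<-neg (+ n)    rewrite shift-pos (suc k) n | shift-pos (suc k) (bump (suc k) n) = refl
  shift²-<-neg -[1+ n ] rewrite shift-negsuc k n | shift-negsuc k (bump k n) = <ᵇ-bump² k n

  descent-pos-shift : descent (+ suc k) (s (+ suc k)) ≡ 0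
  descent-pos-shift rewrite shift-pos (suc k) (suc k) | bump-self (suc k) =
    cong (λ b → if b then 1 else 0) (dec-false (_ ℤ.<? _) (ℤP.<-asym (ℤ.+<+ (ℕP.n<1+n (suc k)))))

  descent-shift-pos : descent (s (+ suc k)) (+ suc k) ≡ 1
  descent-shift-pos rewrite shift-pos (suc k) (suc k) | bump-self (suc k) =
    cong (λ b → if b then 1 else 0) (dec-true (_ ℤ.<? _) (ℤ.+<+ (ℕP.n<1+n (suc k))))

  descent-neg-shift : descent -[1+ k ] (s -[1+ k ]) ≡ 1
  descent-neg-shift rewrite shift-negsuc k k | bump-self k =
    cong (λ b → if b then 1 else 0) (dec-true (_ ℤ.<? _) (ℤ.-<- (ℕP.n<1+n k)))

  descent-shift-neg : descent (s -[1+ k ]) -[1+ k ] ≡ 0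
  descent-shift-neg rewrite shift-negsuc k k | bump-self k =
    cong (λ b → if b then 1 else 0) (dec-false (_ ℤ.<? _) (ℤP.<-asym (ℤ.-<- (ℕP.n<1+n k))))

desList-++ : ∀ X v Y → desList (X ++ v ∷ Y) ≡ desList (X ++ v ∷ []) + desList (v ∷ Y)
desList-++ []          v Y = refl
desList-++ (x ∷ [])    v Y = cong (_+ desList (v ∷ Y)) (sym (ℕP.+-identityʳ (descent x v)))
desList-++ (x ∷ y ∷ X) v Y =
  trans (cong (_+_ (descent x y)) (desList-++ (y ∷ X) v Y))
        (sym (ℕP.+-assoc (descent x y) (desList (y ∷ X ++ v ∷ [])) (desList (v ∷ Y))))

module OrderPreservingMap {h : ℤ → ℤ} (h-mono : OrderPreserving h) where

  desList-map : ∀ l → desList (map h l) ≡ desList l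
  desList-map []          = refl
  desList-map (x ∷ [])    = refl
  desList-map (x ∷ y ∷ l) =
    cong₂ (λ b m → (if b then 1 else 0) + m) (h-mono y x) (desList-map (y ∷ l))

  desList-map-snoc : ∀ {a v X} → All (λ x → (a <ᵇ h x) ≡ (v <ᵇ x)) X →
                     desList (map h X ++ a ∷ []) ≡ desList (X ++ v ∷ [])
  desList-map-snoc []                  = refl
  desList-map-snoc (a≈v ∷ [])          = cong (λ b → (if b then 1 else 0) + 0) a≈v
  desList-map-snoc {X = x ∷ y ∷ X} (_ ∷ sides) =
    cong₂ (λ b m → (if b then 1 else 0) + m) (h-mono y x) (desList-map-snoc sides)

  desList-map-cons : ∀ {b v Y} → All (λ y → (h y <ᵇ b) ≡ (y <ᵇ v)) Y →
                     desList (b ∷ map h Y) ≡ desList (v ∷ Y)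
  desList-map-cons []                    = refl
  desList-map-cons {Y = y ∷ Y} (b≈v ∷ _) =
    cong₂ (λ b m → (if b then 1 else 0) + m) b≈v (desList-map (y ∷ Y))

  desList-map-insert-pair : ∀ {a b v} X Y →
    All (λ x → (a <ᵇ h x) ≡ (v <ᵇ x)) X → All (λ y → (h y <ᵇ b) ≡ (y <ᵇ v)) Y →
    desList (map h X ++ a ∷ b ∷ map h Y) ≡ desList (X ++ v ∷ Y) + descent a b
  desList-map-insert-pair {a} {b} {v} X Y sidesX sidesY = begin
    desList (map h X ++ a ∷ b ∷ map h Y)
      ≡⟨ desList-++ (map h X) a (b ∷ map h Y) ⟩
    desList (map h X ++ a ∷ []) + (descent a b + desList (b ∷ map h Y))
      ≡⟨ cong₂ (λ m n → m + (descent a b + n)) (desList-map-snoc sidesX) (desList-map-cons sidesY) ⟩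
    desList (X ++ v ∷ []) + (descent a b + desList (v ∷ Y))
      ≡⟨ cong (_+_ (desList (X ++ v ∷ []))) (ℕP.+-comm (descent a b) (desList (v ∷ Y))) ⟩
    desList (X ++ v ∷ []) + (desList (v ∷ Y) + descent a b)
      ≡⟨ ℕP.+-assoc (desList (X ++ v ∷ [])) (desList (v ∷ Y)) (descent a b) ⟨
    desList (X ++ v ∷ []) + desList (v ∷ Y) + descent a b
      ≡⟨ cong (_+ descent a b) (desList-++ X v Y) ⟨
    desList (X ++ v ∷ Y) + descent a b ∎

  compare-map-left : ∀ v X → All (λ x → (h v <ᵇ h x) ≡ (v <ᵇ x)) X
  compare-map-left v = universal (h-mono v)

  compare-map-right : ∀ v Y → All (λ y → (h y <ᵇ h v) ≡ (y <ᵇ v)) Y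
  compare-map-right v = universal (λ y → h-mono y v)

insertAt-map-insertAt : ∀ (f : ℤ → ℤ) k v w l → k ≤ length l →
  insertAt (suc k) w (map f (insertAt (suc k) v l)) ≡ map f (take k l) ++ w ∷ f v ∷ map f (drop k l)
insertAt-map-insertAt f zero    v w l       _         = refl
insertAt-map-insertAt f (suc k) v w (x ∷ l) (s≤s k≤l) = cong (f x ∷_) (insertAt-map-insertAt f k v w l k≤l)

insertAt-suc-map-insertAt : ∀ (f : ℤ → ℤ) k v w l → k ≤ length l →
  insertAt (suc (suc k)) w (map f (insertAt (suc k) v l)) ≡ map f (take k l) ++ f v ∷ w ∷ map f (drop k l)
insertAt-suc-map-insertAt f zero    v w l       _         = refl
insertAt-suc-map-insertAt f (suc k) v w (x ∷ l) (s≤s k≤l) = cong (f x ∷_) (insertAt-suc-map-insertAt f k v w l k≤l)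

module _ (k : ℕ) (π : List ℤ) (k≤∣π∣ : k ≤ length π) where

  private
    s : ℤ → ℤ
    s = shift (suc k)

    open OrderPreservingMap {h = s} (shift-monotone k)

    -- The leading + 0 of desB is a fixed point of s, so it can be kept inside the mapped prefix.
    X₀ Y₀ X Y : List ℤ
    X₀ = + 0 ∷ take k π
    Y₀ = drop k π
    X = map s X₀
    Y = map s Y₀

    desB-insert : ∀ v → desB (insertAt (suc k) v (map s π)) ≡ desList (X ++ v ∷ Y)
    desB-insert v = cong₂ (λ P Q → desList (+ 0 ∷ P ++ v ∷ Q)) (take-map k π) (drop-map k π)

    map-shift-take : map s (take k (map s π)) ≡ map s (map s (take k π))
    map-shift-take = cong (map s) (take-map k π)

    map-shift-drop : map s (drop k (map s π)) ≡ map s Y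
    map-shift-drop = cong (map s) (drop-map k π)

    k≤∣sπ∣ : k ≤ length (map s π)
    k≤∣sπ∣ = subst (k ≤_) (sym (length-map s π)) k≤∣π∣

    desB-insert-twice : ∀ v w → desB (insertAt (suc k) w (map s (insertAt (suc k) v (map s π))))
                                ≡ desList (map s X ++ w ∷ s v ∷ map s Y)
    desB-insert-twice v w =
      trans (cong desB (insertAt-map-insertAt s k v w (map s π) k≤∣sπ∣))
            (cong₂ (λ P Q → desList (+ 0 ∷ P ++ w ∷ s v ∷ Q)) map-shift-take map-shift-drop)

    desB-insert-twice-suc : ∀ v w → desB (insertAt (suc (suc k)) w (map s (insertAt (suc k) v (map s π))))
                                    ≡ desList (map s X ++ s v ∷ w ∷ map s Y)
    desB-insert-twice-suc v w =
      trans (cong desB (insertAt-suc-map-insertAt s k v w (map s π) k≤∣sπ∣))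
            (cong₂ (λ P Q → desList (+ 0 ∷ P ++ s v ∷ w ∷ Q)) map-shift-take map-shift-drop)

    values-of-s : ∀ {P : ℤ → Set} → (∀ z → P (s z)) → ∀ l → All P (map s l)
    values-of-s Ps l = map⁺ (universal Ps l)

  desB-η : desB (η (suc k) π) ≡ desB (φ (suc k) (suc k) π)
  desB-η = begin
    desB (η (suc k) π)
      ≡⟨ desB-insert-twice v v ⟩
    desList (map s X ++ v ∷ s v ∷ map s Y)
      ≡⟨ desList-map-insert-pair X Y
           (values-of-s (pos-<-shift² k) X₀) (compare-map-right v Y) ⟩
    desList (X ++ v ∷ Y) + descent v (s v)
      ≡⟨ cong₂ _+_ (sym (desB-insert v)) (descent-pos-shift k) ⟩
    desB (φ (suc k) (suc k) π) + 0
      ≡⟨ ℕP.+-identityʳ _ ⟩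
    desB (φ (suc k) (suc k) π) ∎
    where v = + suc k

  desB-η′ : desB (η′ (suc k) π) ≡ desB (φ (suc k) (suc k) π) + 1
  desB-η′ = begin
    desB (η′ (suc k) π)
      ≡⟨ desB-insert-twice-suc v v ⟩
    desList (map s X ++ s v ∷ v ∷ map s Y)
      ≡⟨ desList-map-insert-pair X Y
           (compare-map-left v X) (universal (shift-<-pos k) Y) ⟩
    desList (X ++ v ∷ Y) + descent (s v) v
      ≡⟨ cong₂ _+_ (sym (desB-insert v)) (descent-shift-pos k) ⟩
    desB (φ (suc k) (suc k) π) + 1 ∎
    where v = + suc k

  desB-η̄ : desB (η̄ (suc k) π) ≡ desB (φ̄ (suc k) (suc k) π) + 1
  desB-η̄ = begin
    desB (η̄ (suc k) π)
      ≡⟨ desB-insert-twice v v ⟩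
    desList (map s X ++ v ∷ s v ∷ map s Y)
      ≡⟨ desList-map-insert-pair X Y
           (universal (neg-<-shift k) X) (compare-map-right v Y) ⟩
    desList (X ++ v ∷ Y) + descent v (s v)
      ≡⟨ cong₂ _+_ (sym (desB-insert v)) (descent-neg-shift k) ⟩
    desB (φ̄ (suc k) (suc k) π) + 1 ∎
    where v = -[1+ k ]

  desB-η̄′ : desB (η̄′ (suc k) π) ≡ desB (φ̄ (suc k) (suc k) π)
  desB-η̄′ = begin
    desB (η̄′ (suc k) π)
      ≡⟨ desB-insert-twice-suc v v ⟩
    desList (map s X ++ s v ∷ v ∷ map s Y)
      ≡⟨ desList-map-insert-pair X Y
           (compare-map-left v X) (values-of-s (shift²-<-neg k) Y₀) ⟩
    desList (X ++ v ∷ Y) + descent (s v) v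
      ≡⟨ cong₂ _+_ (sym (desB-insert v)) (descent-shift-neg k) ⟩
    desB (φ̄ (suc k) (suc k) π) + 0
      ≡⟨ ℕP.+-identityʳ _ ⟩
    desB (φ̄ (suc k) (suc k) π) ∎
    where v = -[1+ k ]

proposition5p4 : (n : ℕ) (π : List ℤ) → length π ≡ n → IsSignedInvolution π →
    (i : ℕ) → 1 ≤ i → i ≤ suc n → (p : ℕ) → p ≤ 1 →
    ((desB (φ i i π) ≡ desB π + p × idesB (φ i i π) ≡ idesB π + p) →
       desB (η i π) ≡ desB π + p × desB (η′ i π) ≡ desB π + p + 1)
    × ((desB (φ̄ i i π) ≡ desB π + p × idesB (φ̄ i i π) ≡ idesB π + p) →
       desB (η̄ i π) ≡ desB π + p + 1 × desB (η̄′ i π) ≡ desB π + p)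
proposition5p4 n π refl _ (suc k) (s≤s z≤n) (s≤s k≤n) p _ =
  (λ (desB-φ , _) → trans (desB-η k π k≤n) desB-φ , trans (desB-η′ k π k≤n) (cong (_+ 1) desB-φ)) ,
  (λ (desB-φ̄ , _) → trans (desB-η̄ k π k≤n) (cong (_+ 1) desB-φ̄) , trans (desB-η̄′ k π k≤n) desB-φ̄)
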